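{- Let $G$ be a $K_2$-hypohamiltonian graph containing a diamond with vertices $a,b,c,d$ and central edge $ac$ (i.e.\ $G$ contains the edges $ab,ad,cb,cd,ac$). Then $a$ and $c$ each have degree at least $5$ in $G$.
   Context: All graphs are finite, simple and connected. A graph is hamiltonian if it has a cycle through all its vertices. $G$ is $K_2$-hamiltonian if $G-x-y$ is hamiltonian for every pair of adjacent vertices $x,y$, and $K_2$-hypohamiltonian if moreover $G$ is not hamiltonian. A diamond is $K_4$ with one edge removed; its central edge is the edge joining its two vertices of degree $3$ (within the diamond). -}

module Defs where

open import Data.Nat using (ℕ; _≤_)
open import Data.Bool using (Bool; true; false)
open import Data.Fin using (Fin)
open import Data.List using (List; []; _∷_; _++_; length; take; filterᵇ; allFin; head; last)
open import Data.Maybe using (just)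
open import Data.Product using (Σ; _×_; ∃)
open import Data.List.Relation.Unary.Linked using (Linked)
open import Data.List.Relation.Unary.Unique.Propositional using (Unique)
open import Data.List.Membership.Propositional using (_∈_)
open import Function.Bundles using (_⇔_)
open import Relation.Binary.PropositionalEquality using (_≡_; _≢_)
open import Relation.Nullary using (¬_)

record Graph (n : ℕ) : Set where
  field
    adj   : Fin n → Fin n → Bool
    sym   : ∀ u v → adj u v ≡ adj v u
    irref : ∀ v → adj v v ≡ false

module _ {n : ℕ} (G : Graph n) where
  open Graph G

  E : Fin n → Fin n → Set
  E u v = adj u v ≡ true

  Connected : Set
  Connected = ∀ u v → Σ (List (Fin n)) λ ws →
    Linked E ws × head ws ≡ just u × last ws ≡ just v

  degree : Fin n → ℕ
  degree u = length (filterᵇ (adj u) (allFin n))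

  HamiltonianCycleOn : (Fin n → Set) → List (Fin n) → Set
  HamiltonianCycleOn P vs =
    3 ≤ length vs × Unique vs × (∀ v → (v ∈ vs) ⇔ P v) × Linked E (vs ++ take 1 vs)

  HamiltonianOn : (Fin n → Set) → Set
  HamiltonianOn P = ∃ λ vs → HamiltonianCycleOn P vs

  Hamiltonian : Set
  Hamiltonian = HamiltonianOn (λ _ → Data.Unit.⊤)
    where import Data.Unit

  K₂-Hamiltonian : Set
  K₂-Hamiltonian = ∀ x y → E x y → HamiltonianOn (λ v → v ≢ x × v ≢ y)

  K₂-Hypohamiltonian : Set
  K₂-Hypohamiltonian = K₂-Hamiltonian × ¬ Hamiltonian

  -- a, b, c, d are four distinct vertices spanning a diamond with central edge ac
  -- (the edges ab, ad, cb, cd, ac are present; bd may or may not be an edge)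
  DiamondWithCentralEdge : Fin n → Fin n → Fin n → Fin n → Set
  DiamondWithCentralEdge a b c d =
    E a b × E a d × E c b × E c d × E a c × b ≢ d

-- Let H be a hamiltonian cycle of G - c - d (it exists since cd is an edge);
-- a lies on H. If b were one of the two neighbours of a on H, replacing the
-- edge ab of H by the path a d c b (or ba by b c d a) would give a hamiltonian
-- cycle of G. Hence the H-neighbours x ≠ y of a avoid b, c and d, and
-- b, c, d, x, y are five distinct neighbours of a. The same argument applies
-- to c, since the diamond is symmetric in a and c.
module Submission where

open import Defs
open import Data.Bool using (T?)
open import Data.Bool.Properties using (T-≡)
open import Data.Empty using (⊥-elim)
open import Data.Fin using (Fin; _≟_)
open import Data.List using (List; []; _∷_; _++_; _∷ʳ_; [_]; length; take; initLast; _∷ʳ′_)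
open import Data.List.Properties using (++-assoc; ++-identityʳ)
open import Data.List.Membership.Propositional using (_∈_)
open import Data.List.Membership.Propositional.Properties using (∈-filter⁺; ∈-allFin; ∈-∃++)
open import Data.List.Relation.Binary.Permutation.Propositional using (_↭_; ↭-sym; ↭⇒↭ₛ)
open import Data.List.Relation.Binary.Permutation.Propositional.Properties using (∈-resp-↭; ↭-length; ++-comm)
import Data.List.Relation.Binary.Permutation.Setoid.Properties as Permutationₛ
open import Data.List.Relation.Binary.Subset.Propositional using (_⊆_)
open import Data.List.Relation.Unary.All as All using (All; []; _∷_)
open import Data.List.Relation.Unary.AllPairs as AllPairs using ([]; _∷_)
open import Data.List.Relation.Unary.Any using (here; there)
open import Data.List.Relation.Unary.Linked using (Linked; [-]; _∷_)
open import Data.List.Relation.Unary.Unique.Propositional using (Unique)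
open import Data.Nat using (ℕ; suc; _≤_; z≤n; s≤s; s≤s⁻¹)
open import Data.Product using (_×_; _,_; proj₁; proj₂; ∃; ∃₂)
open import Data.Sum as Sum using (_⊎_; inj₁; inj₂)
open import Function using (_∘_)
open import Function.Bundles using (mk⇔; Equivalence)
open import Relation.Binary.PropositionalEquality as ≡ using (_≡_; _≢_; refl; sym; subst; cong; ≢-sym)
open import Relation.Nullary using (¬_; yes; no)

module _ {A : Set} where

  Unique-resp-↭ : {xs ys : List A} → xs ↭ ys → Unique xs → Unique ys
  Unique-resp-↭ xs↭ys = Permutationₛ.Unique-resp-↭ (≡.setoid A) (↭⇒↭ₛ xs↭ys)

  ∈⇒∃-removal : ∀ {y : A} xs → y ∈ xs → ∃ λ xs′ →
    length xs ≡ suc (length xs′) × (∀ {z} → z ∈ xs → z ≢ y → z ∈ xs′)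
  ∈⇒∃-removal (x ∷ xs) (here refl) =
    xs , refl , λ { (here refl) y≢y → ⊥-elim (y≢y refl) ; (there z∈xs) _ → z∈xs }
  ∈⇒∃-removal (x ∷ xs) (there y∈xs) with xs′ , eq , keep ← ∈⇒∃-removal xs y∈xs =
    x ∷ xs′ , cong suc eq , λ { (here refl) _ → here refl ; (there z∈xs) z≢y → there (keep z∈xs z≢y) }

  Unique-⊆⇒length≤ : ∀ {xs ys : List A} → Unique xs → xs ⊆ ys → length xs ≤ length ys
  Unique-⊆⇒length≤ [] _ = z≤n
  Unique-⊆⇒length≤ {x ∷ xs} {ys} (x∉xs ∷ uniq) x∷xs⊆ys =
    let ys′ , |ys|≡1+|ys′| , keep = ∈⇒∃-removal ys (x∷xs⊆ys (here refl))
        xs⊆ys′ : xs ⊆ ys′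
        xs⊆ys′ z∈xs = keep (x∷xs⊆ys (there z∈xs)) (λ z≡x → All.lookup x∉xs z∈xs (sym z≡x))
    in subst (suc (length xs) ≤_) (sym |ys|≡1+|ys′|) (s≤s (Unique-⊆⇒length≤ uniq xs⊆ys′))

  length≥2⇒∷-∷ʳ : ∀ (ws : List A) → 2 ≤ length ws → ∃₂ λ x m → ∃ λ y → ws ≡ x ∷ m ∷ʳ y
  length≥2⇒∷-∷ʳ (x ∷ ws) _ with initLast ws
  length≥2⇒∷-∷ʳ (x ∷ .[]) (s≤s ()) | []
  ... | m ∷ʳ′ y = x , m , y , refl

module _ {A : Set} {R : A → A → Set} where

  CyclicallyLinked : List A → Set
  CyclicallyLinked xs = Linked R (xs ++ take 1 xs)

  Linked-∷ʳ⁺ : ∀ xs {x y} → Linked R (xs ∷ʳ x) → R x y → Linked R (xs ∷ʳ x ∷ʳ y)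
  Linked-∷ʳ⁺ [] _ Rxy = Rxy ∷ [-]
  Linked-∷ʳ⁺ (_ ∷ []) (Rzx ∷ _) Rxy = Rzx ∷ Rxy ∷ [-]
  Linked-∷ʳ⁺ (_ ∷ zs@(_ ∷ _)) (Rzz′ ∷ Rzs) Rxy = Rzz′ ∷ Linked-∷ʳ⁺ zs Rzs Rxy

  CyclicallyLinked-rotate₁ : ∀ x xs → CyclicallyLinked (x ∷ xs) → CyclicallyLinked (xs ∷ʳ x)
  CyclicallyLinked-rotate₁ x [] Rxx = Rxx
  CyclicallyLinked-rotate₁ x (y ∷ ys) (Rxy ∷ Ryys) = Linked-∷ʳ⁺ (y ∷ ys) Ryys Rxy

  CyclicallyLinked-rotate : ∀ xs ys → CyclicallyLinked (xs ++ ys) → CyclicallyLinked (ys ++ xs)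
  CyclicallyLinked-rotate [] ys cyc = subst CyclicallyLinked (sym (++-identityʳ ys)) cyc
  CyclicallyLinked-rotate (x ∷ xs) ys cyc =
    subst CyclicallyLinked (++-assoc ys [ x ] xs)
      (CyclicallyLinked-rotate xs (ys ∷ʳ x)
        (subst CyclicallyLinked (++-assoc xs ys [ x ]) (CyclicallyLinked-rotate₁ x (xs ++ ys) cyc)))

module _ {n : ℕ} (G : Graph n) where

  E-sym : ∀ {u v} → E G u v → E G v u
  E-sym {u} {v} = ≡.trans (Graph.sym G v u)

  E-irrefl : ∀ {u v} → E G u v → u ≢ v
  E-irrefl {u} e refl with ≡.trans (sym e) (Graph.irref G u)
  ... | ()

  Unique-neighbours⇒length≤degree : ∀ {u vs} → Unique vs → All (E G u) vs → length vs ≤ degree G u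
  Unique-neighbours⇒length≤degree {u} uniq adjacent = Unique-⊆⇒length≤ uniq λ v∈vs →
    ∈-filter⁺ (T? ∘ Graph.adj G u) (∈-allFin _) (Equivalence.from T-≡ (All.lookup adjacent v∈vs))

  module _ {P : Fin n → Set} where

    HamiltonianCycleOn-∈ : ∀ {vs v} → HamiltonianCycleOn G P vs → v ∈ vs → P v
    HamiltonianCycleOn-∈ (_ , _ , mem , _) = Equivalence.to (mem _)

    HamiltonianCycleOn-∋ : ∀ {vs v} → HamiltonianCycleOn G P vs → P v → v ∈ vs
    HamiltonianCycleOn-∋ (_ , _ , mem , _) = Equivalence.from (mem _)

    HamiltonianCycleOn-edge : ∀ {u v ws} → HamiltonianCycleOn G P (u ∷ v ∷ ws) → E G u v
    HamiltonianCycleOn-edge (_ , _ , _ , Euv ∷ _) = Euv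

    HamiltonianCycleOn-rotate : ∀ xs ys → HamiltonianCycleOn G P (xs ++ ys) → HamiltonianCycleOn G P (ys ++ xs)
    HamiltonianCycleOn-rotate xs ys (length≥3 , uniq , mem , cyc) =
      subst (3 ≤_) (↭-length xs++ys↭ys++xs) length≥3 ,
      Unique-resp-↭ xs++ys↭ys++xs uniq ,
      (λ v → mk⇔ (Equivalence.to (mem v) ∘ ∈-resp-↭ (↭-sym xs++ys↭ys++xs))
                 (∈-resp-↭ xs++ys↭ys++xs ∘ Equivalence.from (mem v))) ,
      CyclicallyLinked-rotate xs ys cyc
      where
      xs++ys↭ys++xs : xs ++ ys ↭ ys ++ xs
      xs++ys↭ys++xs = ++-comm xs ys

    HamiltonianCycleOn-startingAt : ∀ {vs a} → HamiltonianCycleOn G P vs → a ∈ vs →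
      ∃₂ λ x m → ∃ λ y → HamiltonianCycleOn G P (a ∷ x ∷ m ∷ʳ y)
    HamiltonianCycleOn-startingAt {a = a} ham a∈vs with p , q , refl ← ∈-∃++ a∈vs =
      let ham′ = HamiltonianCycleOn-rotate p (a ∷ q) ham
          x , m , y , eq = length≥2⇒∷-∷ʳ (q ++ p) (s≤s⁻¹ (proj₁ ham′))
      in x , m , y , subst (λ ws → HamiltonianCycleOn G P (a ∷ ws)) eq ham′

    HamiltonianCycleOn-insert : ∀ {u v ws s t} → HamiltonianCycleOn G P (u ∷ v ∷ ws) →
      ¬ P s → ¬ P t → s ≢ t → E G u s → E G s t → E G t v →
      HamiltonianCycleOn G (λ w → P w ⊎ w ≡ s ⊎ w ≡ t) (u ∷ s ∷ t ∷ v ∷ ws)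
    HamiltonianCycleOn-insert {u} {v} {ws} {s} {t} (_ , u∉ ∷ uniq , mem , _ ∷ cyc) ¬Ps ¬Pt s≢t Eus Est Etv =
      s≤s (s≤s (s≤s z≤n)) ,
      (≢-sym s≢u ∷ ≢-sym t≢u ∷ u∉) ∷ (s≢t ∷ s∉) ∷ t∉ ∷ uniq ,
      (λ w → mk⇔ to from) ,
      Eus ∷ Est ∷ Etv ∷ cyc
      where
      fresh : ∀ {w} → ¬ P w → All (w ≢_) (u ∷ v ∷ ws)
      fresh ¬Pw = All.tabulate λ z∈ w≡z → ¬Pw (subst P (sym w≡z) (Equivalence.to (mem _) z∈))
      s≢u = All.head (fresh ¬Ps)
      s∉ = All.tail (fresh ¬Ps)
      t≢u = All.head (fresh ¬Pt)
      t∉ = All.tail (fresh ¬Pt)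
      to : ∀ {w} → w ∈ u ∷ s ∷ t ∷ v ∷ ws → P w ⊎ w ≡ s ⊎ w ≡ t
      to (here refl) = inj₁ (Equivalence.to (mem _) (here refl))
      to (there (here refl)) = inj₂ (inj₁ refl)
      to (there (there (here refl))) = inj₂ (inj₂ refl)
      to (there (there (there w∈))) = inj₁ (Equivalence.to (mem _) (there w∈))
      from : ∀ {w} → P w ⊎ w ≡ s ⊎ w ≡ t → w ∈ u ∷ s ∷ t ∷ v ∷ ws
      from (inj₁ Pw) with Equivalence.from (mem _) Pw
      ... | here refl = here refl
      ... | there w∈ = there (there (there w∈))
      from (inj₂ (inj₁ refl)) = there (here refl)
      from (inj₂ (inj₂ refl)) = there (there (here refl))

    HamiltonianCycleOn⇒Hamiltonian : ∀ {vs} → (∀ v → P v) → HamiltonianCycleOn G P vs → Hamiltonian G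
    HamiltonianCycleOn⇒Hamiltonian {vs} all (length≥3 , uniq , mem , cyc) =
      vs , length≥3 , uniq , (λ v → mk⇔ _ (λ _ → Equivalence.from (mem v) (all v))) , cyc

avoids⊎hits : ∀ {n} (c d v : Fin n) → (v ≢ c × v ≢ d) ⊎ v ≡ c ⊎ v ≡ d
avoids⊎hits c d v with v ≟ c | v ≟ d
... | yes v≡c | _ = inj₂ (inj₁ v≡c)
... | no _ | yes v≡d = inj₂ (inj₂ v≡d)
... | no v≢c | no v≢d = inj₁ (v≢c , v≢d)

module _ {n : ℕ} (G : Graph n) (hypo : K₂-Hypohamiltonian G) {a b c d : Fin n}
         (Eab : E G a b) (Ead : E G a d) (Eac : E G a c) (Ecb : E G c b) (Ecd : E G c d) (b≢d : b ≢ d)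
         where

  private
    Avoids : Fin n → Set
    Avoids v = v ≢ c × v ≢ d

    c≢d : c ≢ d
    c≢d = E-irrefl G Ecd

    ¬Avoids-c : ¬ Avoids c
    ¬Avoids-c (c≢c , _) = c≢c refl

    ¬Avoids-d : ¬ Avoids d
    ¬Avoids-d (_ , d≢d) = d≢d refl

    ¬HamiltonianCycleOn-a∷b∷ : ∀ {ws} → ¬ HamiltonianCycleOn G Avoids (a ∷ b ∷ ws)
    ¬HamiltonianCycleOn-a∷b∷ ham = proj₂ hypo (HamiltonianCycleOn⇒Hamiltonian G (Sum.map₂ Sum.swap ∘ avoids⊎hits c d)
      (HamiltonianCycleOn-insert G ham ¬Avoids-d ¬Avoids-c (≢-sym c≢d) Ead (E-sym G Ecd) Ecb))

    ¬HamiltonianCycleOn-b∷a∷ : ∀ {ws} → ¬ HamiltonianCycleOn G Avoids (b ∷ a ∷ ws)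
    ¬HamiltonianCycleOn-b∷a∷ ham = proj₂ hypo (HamiltonianCycleOn⇒Hamiltonian G (avoids⊎hits c d)
      (HamiltonianCycleOn-insert G ham ¬Avoids-c ¬Avoids-d c≢d (E-sym G Ecb) Ecd (E-sym G Ead)))

    degree≥5-from-cycle : ∀ {x m y} → HamiltonianCycleOn G Avoids (a ∷ x ∷ m ∷ʳ y) → 5 ≤ degree G a
    degree≥5-from-cycle {x} {m} {y} ham =
      Unique-neighbours⇒length≤degree G neighbours-unique (Eab ∷ Eac ∷ Ead ∷ Eax ∷ Eay ∷ [])
      where
      ham′ : HamiltonianCycleOn G Avoids (y ∷ a ∷ x ∷ m)
      ham′ = HamiltonianCycleOn-rotate G (a ∷ x ∷ m) [ y ] ham
      Eax : E G a x
      Eax = HamiltonianCycleOn-edge G ham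
      Eay : E G a y
      Eay = E-sym G (HamiltonianCycleOn-edge G ham′)
      x-avoids : Avoids x
      x-avoids = HamiltonianCycleOn-∈ G ham (there (here refl))
      y-avoids : Avoids y
      y-avoids = HamiltonianCycleOn-∈ G ham′ (here refl)
      y≢x : y ≢ x
      y≢x = All.lookup (AllPairs.head (proj₁ (proj₂ ham′))) (there (here refl))
      x≢b : x ≢ b
      x≢b refl = ¬HamiltonianCycleOn-a∷b∷ ham
      y≢b : y ≢ b
      y≢b refl = ¬HamiltonianCycleOn-b∷a∷ ham′
      neighbours-unique : Unique (b ∷ c ∷ d ∷ x ∷ y ∷ [])
      neighbours-unique =
        (≢-sym (E-irrefl G Ecb) ∷ b≢d ∷ ≢-sym x≢b ∷ ≢-sym y≢b ∷ []) ∷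
        (c≢d ∷ ≢-sym (proj₁ x-avoids) ∷ ≢-sym (proj₁ y-avoids) ∷ []) ∷
        (≢-sym (proj₂ x-avoids) ∷ ≢-sym (proj₂ y-avoids) ∷ []) ∷
        (≢-sym y≢x ∷ []) ∷ [] ∷ []

  degree≥5 : 5 ≤ degree G a
  degree≥5 with _ , ham ← proj₁ hypo c d Ecd
    with _ , _ , _ , hamₐ ← HamiltonianCycleOn-startingAt G ham
                               (HamiltonianCycleOn-∋ G ham (E-irrefl G Eac , E-irrefl G Ead)) =
    degree≥5-from-cycle hamₐ

corollary4 : (n : ℕ) (G : Graph n) → Connected G → K₂-Hypohamiltonian G →
    (a b c d : Fin n) → DiamondWithCentralEdge G a b c d →
    5 ≤ degree G a × 5 ≤ degree G c
corollary4 n G _ hypo a b c d (Eab , Ead , Ecb , Ecd , Eac , b≢d) =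
  degree≥5 G hypo Eab Ead Eac Ecb Ecd b≢d ,
  degree≥5 G hypo Ecb Ecd (E-sym G Eac) Eab Ead b≢d
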